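{- Let $C\subseteq\{0,1\}^n$ be a binary linear code which is a perfect $3$-locally correctable code, i.e., for every coordinate $i\in[n]$, either $C^\perp$ contains $e_i$, or $C^\perp$ contains at least $\frac{n-1}{3}$ vectors of Hamming weight $4$ whose supports all contain $i$ and are pairwise disjoint apart from $i$. Let $\mathbb T$ be the coset leader graph of $C$, and for $r\ge0$ let $S_r$ be the set of vertices of $\mathbb T$ at distance exactly $r$ from the vertex $C^\perp$. Let $r\ge2$ and assume $S_r\neq\emptyset$. Then every vertex $x+C^\perp\in S_r$ is joined by at least $\lfloor r/2\rfloor^2$ edges (counted with multiplicity) to vertices in $S_{r-1}$.
   Context: $C^\perp$ is the dual code of $C$ over $\mathbb F_2$. The coset leader graph of $C$ is the Cayley multigraph of the quotient group $\mathbb F_2^n/C^\perp$ with respect to the generators $e_1+C^\perp,\dots,e_n+C^\perp$, where $e_i$ are the standard basis vectors; distance is the shortest-path distance. -}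

module Defs where

open import Data.Bool using (Bool; true; false; _xor_; _∧_; if_then_else_)
open import Data.Nat using (ℕ; zero; suc; _+_; _*_; _∸_; _≤_; _<_)
open import Data.Fin using (Fin; _≟_)
open import Data.List using (List; []; _∷_; length; map; foldr; allFin)
open import Data.Nat.ListAction using (sum)
open import Data.List.Relation.Unary.All using (All)
open import Data.List.Relation.Unary.AllPairs using (AllPairs)
open import Data.Product using (Σ; _×_; ∃)
open import Data.Sum using (_⊎_)
open import Relation.Binary.PropositionalEquality using (_≡_; _≢_)
open import Relation.Nullary using (¬_; does)

-- Vectors of F_2^n, as functions Fin n → Bool (true = 1).
Word : ℕ → Set
Word n = Fin n → Bool

0w : ∀ {n} → Word n
0w _ = false

_⊕_ : ∀ {n} → Word n → Word n → Word n
(u ⊕ v) j = u j xor v j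

e : ∀ {n} → Fin n → Word n
e i j = does (i ≟ j)

dot : ∀ {n} → Word n → Word n → Bool
dot {n} u v = foldr _xor_ false (map (λ j → u j ∧ v j) (allFin n))

weight : ∀ {n} → Word n → ℕ
weight {n} v = sum (map (λ j → if v j then 1 else 0) (allFin n))

-- A binary linear code: a subset of F_2^n containing 0 and closed under +
-- (over F_2 this is exactly an F_2-subspace).
IsLinearCode : ∀ {n} → (Word n → Set) → Set
IsLinearCode {n} C = C 0w × (∀ u v → C u → C v → C (u ⊕ v))

Dual : ∀ {n} → (Word n → Set) → Word n → Set
Dual {n} C y = ∀ c → C c → dot y c ≡ false

DisjointApart : ∀ {n} → Fin n → Word n → Word n → Set
DisjointApart {n} i v w = ∀ j → j ≢ i → v j ≡ true → w j ≡ true → Data.Empty.⊥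
  where import Data.Empty

IsPerfect3LCC : ∀ {n} → (Word n → Set) → Set
IsPerfect3LCC {n} C =
  (i : Fin n) →
    Dual C (e i) ⊎
    Σ (List (Word n)) (λ L →
        (n ∸ 1 ≤ 3 * length L)
      × All (λ v → Dual C v × weight v ≡ 4 × v i ≡ true) L
      × AllPairs (DisjointApart i) L)

-- Coset leader graph: Cayley multigraph on F_2^n / D (D = C^⊥) with
-- generators e_i + D.  Vertices are represented by coset representatives;
-- two representatives u, v denote the same vertex iff u ⊕ v ∈ D.
-- The edge labelled i joins u + D to (u ⊕ e_i) + D.
data Walk {n} (D : Word n → Set) : ℕ → Word n → Word n → Set where
  stop : ∀ {u v} → D (u ⊕ v) → Walk D zero u v
  step : ∀ {k u v} (i : Fin n) → Walk D k (u ⊕ e i) v → Walk D (suc k) u v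

InSphere : ∀ {n} → (Word n → Set) → ℕ → Word n → Set
InSphere D r x = Walk D r 0w x × (∀ k → k < r → ¬ Walk D k 0w x)

module Submission where

-- Let y be a coset leader of x, of weight r. For distinct i, a in the support of y, the repair
-- group of i through a is a weight-4 codeword v meeting y exactly in {i, a}: a third common point
-- would give a lighter word y + v in the coset. Its two remaining coordinates t therefore give
-- words y + v + e_t of weight r - 1 in the coset of x + e_t, i.e. neighbours in S_{r-1}.
-- Split the support of y into A₁ of size ⌊r/2⌋ and the rest A₂. For fixed a ∈ A₂ the tails
-- v - {i, a}, i ∈ A₁, are linearly independent (a vanishing combination would put a nonzero
-- codeword under y), so their union has at least |A₁| coordinates; and the unions for distinct
-- a, a' are disjoint (two blocks sharing a coordinate add up to a codeword of weight ≤ 6 meeting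
-- y in four points). This yields |A₂| |A₁| ≥ ⌊r/2⌋² coordinates t with x + e_t ∈ S_{r-1}.

open import Defs
open import Algebra.Bundles using (CommutativeRing)
open import Data.Bool using (Bool; true; false; _xor_; _∧_; _∨_; not; if_then_else_)
open import Data.Bool.Properties using (xor-∧-commutativeRing; xor-assoc; xor-comm; xor-same; xor-identityʳ; ∧-assoc; ∧-identityʳ; ∧-zeroʳ; ∧-distribˡ-xor; ∧-distribʳ-xor; ∨-zeroʳ; ¬-not) renaming (_≟_ to _≟ᵇ_)
open import Algebra.Properties.CommutativeSemigroup (CommutativeRing.+-commutativeSemigroup xor-∧-commutativeRing) using () renaming (interchange to xor-interchange; xy∙z≈xz∙y to xor-swapʳ; xy∙z≈x∙zy to xor-rotate)
open import Data.Empty using (⊥; ⊥-elim)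
open import Data.Fin using (Fin; _≟_)
open import Data.List using (List; []; _∷_; length; map; foldr; allFin; filter; take; drop)
open import Data.List.Properties using (length-map; length-take; length-drop; length-tabulate; map-cong)
open import Data.List.Membership.Propositional using (_∈_; _∉_; find)
open import Data.List.Membership.Propositional.Properties using (∈-allFin)
open import Data.List.Relation.Unary.All as All using (All; []; _∷_)
import Data.List.Relation.Unary.All.Properties as Allₚ
open import Data.List.Relation.Unary.Any as Any using (Any; here; there; any?)
import Data.List.Relation.Unary.Any.Properties as Anyₚ
open import Data.List.Relation.Unary.AllPairs using (AllPairs; []; _∷_)
import Data.List.Relation.Unary.AllPairs.Properties as AllPairsₚ
open import Data.List.Relation.Unary.Unique.Propositional using (Unique)
open import Data.List.Relation.Unary.Unique.Propositional.Properties using (allFin⁺; filter⁺; take⁺; drop⁺)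
open import Data.Nat using (ℕ; zero; suc; _+_; _*_; _∸_; _⊓_; _≤_; _<_; _≤?_; z≤n; s≤s)
open import Data.Nat.DivMod using (_/_; m/n≤m; m/n*n≤m)
open import Data.Nat.ListAction using (sum)
open import Data.Nat.Properties using (≤-trans; ≤-antisym; ≤-reflexive; +-comm; +-identityʳ; +-suc; +-mono-≤; +-monoˡ-≤; +-monoʳ-≤; +-cancelʳ-≡; +-cancelˡ-≤; +-cancelʳ-≤; *-comm; *-distribˡ-+; *-mono-≤; *-monoʳ-≤; *-cancelˡ-≤; m≤m+n; m≤n+m∸n; m+n∸n≡m; m+n≤o⇒m≤o∸n; m≤n⇒m⊓n≡m; n≤0⇒n≡0; <⇒≱; ≮⇒≥; 1+n≰n; suc-injective; module ≤-Reasoning)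
open import Data.Nat.Tactic.RingSolver using (solve-∀)
open import Data.Product using (Σ; _×_; _,_; proj₁; proj₂)
open import Data.Sum using (_⊎_; inj₁; inj₂; [_,_]′)
open import Relation.Binary.PropositionalEquality using (_≡_; _≢_; _≗_; refl; sym; trans; cong; cong₂; subst; ≢-sym; module ≡-Reasoning)
open import Relation.Nullary using (¬_; yes; no; contradiction)
open import Relation.Nullary.Decidable using (dec-true; dec-false; from-no)

private
  variable
    n : ℕ

_∩_ : Word n → Word n → Word n
(u ∩ v) j = u j ∧ v j

_∪_ : Word n → Word n → Word n
(u ∪ v) j = u j ∨ v j

∁ : Word n → Word n
∁ u j = not (u j)

infix 4 _⊆_

_⊆_ : Word n → Word n → Set
u ⊆ v = ∀ j → u j ≡ true → v j ≡ true

Disjoint : Word n → Word n → Set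
Disjoint u v = ∀ j → u j ≡ true → v j ≡ true → ⊥

xor-cancel-shared : ∀ a b c → (a xor c) xor (b xor c) ≡ a xor b
xor-cancel-shared a b c = begin
  (a xor c) xor (b xor c) ≡⟨ xor-interchange a c b c ⟩
  (a xor b) xor (c xor c) ≡⟨ cong ((a xor b) xor_) (xor-same c) ⟩
  (a xor b) xor false     ≡⟨ xor-identityʳ (a xor b) ⟩
  a xor b                 ∎
  where open ≡-Reasoning

xor-self-cancelˡ : ∀ a b → a xor (a xor b) ≡ b
xor-self-cancelˡ a b = trans (sym (xor-assoc a a b)) (cong (_xor b) (xor-same a))

xor-self-cancelʳ : ∀ a b → (a xor b) xor b ≡ a
xor-self-cancelʳ a b = trans (xor-assoc a b b) (trans (cong (a xor_) (xor-same b)) (xor-identityʳ a))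

xor-true : ∀ {a b} → a xor b ≡ true → a ≡ true ⊎ b ≡ true
xor-true {true} _ = inj₁ refl
xor-true {false} b≡true = inj₂ b≡true

∩-⊆ : ∀ {u v : Word n} → v ⊆ u → (u ∩ v) ≗ v
∩-⊆ {u = u} {v} v⊆u j with v j in vj
... | true = cong (_∧ true) (v⊆u j vj)
... | false = ∧-zeroʳ (u j)

e-diag : (t : Fin n) → e t t ≡ true
e-diag t = dec-true (t ≟ t) refl

e-off : ∀ {t j : Fin n} → t ≢ j → e t j ≡ false
e-off {t = t} {j} t≢j = dec-false (t ≟ j) t≢j

e-true : ∀ {t j : Fin n} → e t j ≡ true → t ≡ j
e-true {t = t} {j} et with t ≟ j
... | yes t≡j = t≡j

e-⊆ : ∀ {u : Word n} {t} → u t ≡ true → e t ⊆ u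
e-⊆ {u = u} ut j et = subst (λ k → u k ≡ true) (e-true et) ut

-- Weights

bit : Bool → ℕ
bit b = if b then 1 else 0

bit-xor-∧ : ∀ a b → bit (a xor b) + 2 * bit (a ∧ b) ≡ bit a + bit b
bit-xor-∧ false b = +-identityʳ (bit b)
bit-xor-∧ true false = refl
bit-xor-∧ true true = refl

weightOn : List (Fin n) → Word n → ℕ
weightOn l u = sum (map (λ j → bit (u j)) l)

weightOn-⊕-∩ : ∀ l (u v : Word n) → weightOn l (u ⊕ v) + 2 * weightOn l (u ∩ v) ≡ weightOn l u + weightOn l v
weightOn-⊕-∩ [] u v = refl
weightOn-⊕-∩ (j ∷ l) u v = begin
  (bit (u j xor v j) + weightOn l (u ⊕ v)) + 2 * (bit (u j ∧ v j) + weightOn l (u ∩ v))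
    ≡⟨ regroup (bit (u j xor v j)) (weightOn l (u ⊕ v)) (bit (u j ∧ v j)) (weightOn l (u ∩ v)) ⟩
  (bit (u j xor v j) + 2 * bit (u j ∧ v j)) + (weightOn l (u ⊕ v) + 2 * weightOn l (u ∩ v))
    ≡⟨ cong₂ _+_ (bit-xor-∧ (u j) (v j)) (weightOn-⊕-∩ l u v) ⟩
  (bit (u j) + bit (v j)) + (weightOn l u + weightOn l v)
    ≡⟨ interchange (bit (u j)) (bit (v j)) (weightOn l u) (weightOn l v) ⟩
  (bit (u j) + weightOn l u) + (bit (v j) + weightOn l v) ∎
  where
    open ≡-Reasoning
    regroup : ∀ a b c d → (a + b) + 2 * (c + d) ≡ (a + 2 * c) + (b + 2 * d)
    regroup = solve-∀
    interchange : ∀ a b c d → (a + b) + (c + d) ≡ (a + c) + (b + d)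
    interchange = solve-∀

weightOn-cong : ∀ l {u v : Word n} → u ≗ v → weightOn l u ≡ weightOn l v
weightOn-cong l u≗v = cong sum (map-cong (λ j → cong bit (u≗v j)) l)

weightOn-∁ : ∀ l (u : Word n) → weightOn l u + weightOn l (∁ u) ≡ length l
weightOn-∁ [] u = refl
weightOn-∁ (j ∷ l) u with u j
... | true = cong suc (weightOn-∁ l u)
... | false = trans (+-suc (weightOn l u) (weightOn l (∁ u))) (cong suc (weightOn-∁ l u))

weightOn-0w : ∀ (l : List (Fin n)) → weightOn l 0w ≡ 0
weightOn-0w [] = refl
weightOn-0w (j ∷ l) = weightOn-0w l

weightOn-e-∉ : ∀ {t : Fin n} l → t ∉ l → weightOn l (e t) ≡ 0
weightOn-e-∉ [] _ = refl
weightOn-e-∉ {t = t} (j ∷ l) t∉ rewrite e-off {t = t} {j} (λ t≡j → t∉ (here t≡j)) =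
  weightOn-e-∉ l (λ t∈ → t∉ (there t∈))

weightOn-e-∈ : ∀ {t : Fin n} l → Unique l → t ∈ l → weightOn l (e t) ≡ 1
weightOn-e-∈ (j ∷ l) (j∉l ∷ _) (here refl) rewrite e-diag j = cong suc (weightOn-e-∉ l (Allₚ.All¬⇒¬Any j∉l))
weightOn-e-∈ {t = t} (j ∷ l) (j∉l ∷ l-unique) (there t∈l)
  rewrite e-off {t = t} {j} (λ t≡j → Allₚ.All¬⇒¬Any j∉l (subst (_∈ l) t≡j t∈l)) =
  weightOn-e-∈ l l-unique t∈l

weight-⊕-∩ : (u v : Word n) → weight (u ⊕ v) + 2 * weight (u ∩ v) ≡ weight u + weight v
weight-⊕-∩ {n} = weightOn-⊕-∩ (allFin n)

weight-cong : ∀ {u v : Word n} → u ≗ v → weight u ≡ weight v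
weight-cong {n} = weightOn-cong (allFin n)

weight-∁ : (u : Word n) → weight u + weight (∁ u) ≡ n
weight-∁ {n} u = trans (weightOn-∁ (allFin n) u) (length-tabulate {n = n} (λ j → j))

weight-0w : weight (0w {n}) ≡ 0
weight-0w {n} = weightOn-0w (allFin n)

weight-e : (t : Fin n) → weight (e t) ≡ 1
weight-e {n} t = weightOn-e-∈ (allFin n) (allFin⁺ n) (∈-allFin t)

weight-⊕-≤ : (u v : Word n) → weight (u ⊕ v) ≤ weight u + weight v
weight-⊕-≤ u v = ≤-trans (m≤m+n _ _) (≤-reflexive (weight-⊕-∩ u v))

weight-⊕-⊆ : ∀ {u v : Word n} → v ⊆ u → weight (u ⊕ v) + weight v ≡ weight u
weight-⊕-⊆ {u = u} {v} v⊆u = +-cancelʳ-≡ (weight v) _ _ (begin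
  weight (u ⊕ v) + weight v + weight v ≡⟨ double (weight (u ⊕ v)) (weight v) ⟩
  weight (u ⊕ v) + 2 * weight v        ≡⟨ cong (λ k → weight (u ⊕ v) + 2 * k) (weight-cong (∩-⊆ v⊆u)) ⟨
  weight (u ⊕ v) + 2 * weight (u ∩ v)  ≡⟨ weight-⊕-∩ u v ⟩
  weight u + weight v                  ∎)
  where
    open ≡-Reasoning
    double : ∀ a b → a + b + b ≡ a + 2 * b
    double = solve-∀

weight-⊕-e : ∀ {u : Word n} {t} → u t ≡ true → weight (u ⊕ e t) + 1 ≡ weight u
weight-⊕-e {u = u} {t} ut = trans (cong (weight (u ⊕ e t) +_) (sym (weight-e t))) (weight-⊕-⊆ {u = u} {e t} (e-⊆ ut))

unique⇒length≤weight : ∀ (u : Word n) {T} → Unique T → All (λ j → u j ≡ true) T → length T ≤ weight u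
unique⇒length≤weight u {[]} _ _ = z≤n
unique⇒length≤weight u {t ∷ T} (t∉T ∷ T-unique) (ut ∷ uT) = begin
  suc (length T)         ≤⟨ s≤s (unique⇒length≤weight (u ⊕ e t) T-unique (All.zipWith still-one (t∉T , uT))) ⟩
  suc (weight (u ⊕ e t)) ≡⟨ +-comm 1 (weight (u ⊕ e t)) ⟩
  weight (u ⊕ e t) + 1   ≡⟨ weight-⊕-e {u = u} ut ⟩
  weight u               ∎
  where
    open ≤-Reasoning
    still-one : ∀ {j} → t ≢ j × u j ≡ true → (u ⊕ e t) j ≡ true
    still-one {j} (t≢j , uj) = trans (cong (u j xor_) (e-off t≢j)) (trans (xor-identityʳ (u j)) uj)

weight≡0⇒≗0w : ∀ {u : Word n} → weight u ≡ 0 → u ≗ 0w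
weight≡0⇒≗0w {u = u} |u|≡0 j with u j in uj
... | false = refl
... | true = contradiction (subst (1 ≤_) |u|≡0 (unique⇒length≤weight u ([] ∷ []) (uj ∷ []))) λ ()

support : Word n → List (Fin n)
support {n} u = filter (λ j → u j ≟ᵇ true) (allFin n)

support-unique : (u : Word n) → Unique (support u)
support-unique {n} u = filter⁺ (λ j → u j ≟ᵇ true) (allFin⁺ n)

all-support : (u : Word n) → All (λ j → u j ≡ true) (support u)
all-support {n} u = Allₚ.all-filter (λ j → u j ≟ᵇ true) (allFin n)

length-support : (u : Word n) → length (support u) ≡ weight u
length-support {n} u = go (allFin n)
  where
    go : ∀ l → length (filter (λ j → u j ≟ᵇ true) l) ≡ weightOn l u
    go [] = refl
    go (j ∷ l) with u j
    ... | true = cong suc (go l)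
    ... | false = go l

nonzero-witness : (u : Word n) → ¬ (u ≗ 0w) → Σ (Fin n) λ p → u p ≡ true
nonzero-witness u u≢0 with support u | length-support u | all-support u
... | [] | |u|≡0 | _ = contradiction (weight≡0⇒≗0w (sym |u|≡0)) u≢0
... | p ∷ _ | _ | up ∷ _ = p , up

⋃ : List (Word n) → Word n
⋃ = foldr _∪_ 0w

⊆-⋃ : ∀ {w : Word n} {ws} → w ∈ ws → w ⊆ ⋃ ws
⊆-⋃ (here refl) j wj rewrite wj = refl
⊆-⋃ {ws = w′ ∷ _} (there w∈) j wj rewrite ⊆-⋃ w∈ j wj = ∨-zeroʳ (w′ j)

⋃⁻ : ∀ (ws : List (Word n)) {j} → ⋃ ws j ≡ true → Any (λ w → w j ≡ true) ws
⋃⁻ [] ()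
⋃⁻ (w ∷ ws) {j} ⋃j with w j in wj
... | true = here wj
... | false = there (⋃⁻ ws ⋃j)

disjoint-⋃ : ∀ {u : Word n} {ws} → All (Disjoint u) ws → Disjoint u (⋃ ws)
disjoint-⋃ {ws = ws} disj j uj ⋃j = All.lookupWith (λ d wj → d j uj wj) disj (⋃⁻ ws ⋃j)

weight-∪ : ∀ {n} {u v : Word n} → Disjoint u v → weight (u ∪ v) ≡ weight u + weight v
weight-∪ {n} {u} {v} disj = begin
  weight (u ∪ v)                      ≡⟨ weight-cong ∪≗⊕ ⟩
  weight (u ⊕ v)                      ≡⟨ +-identityʳ _ ⟨
  weight (u ⊕ v) + 2 * 0              ≡⟨ cong (λ k → weight (u ⊕ v) + 2 * k) (trans (weight-cong ∩≗0w) (weight-0w {n})) ⟨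
  weight (u ⊕ v) + 2 * weight (u ∩ v) ≡⟨ weight-⊕-∩ u v ⟩
  weight u + weight v                 ∎
  where
    open ≡-Reasoning
    ∩≗0w : (u ∩ v) ≗ 0w
    ∩≗0w j with u j in uj | v j in vj
    ... | true | true = ⊥-elim (disj j uj vj)
    ... | true | false = refl
    ... | false | _ = refl
    ∪≗⊕ : (u ∪ v) ≗ (u ⊕ v)
    ∪≗⊕ j with u j in uj | v j in vj
    ... | true | true = ⊥-elim (disj j uj vj)
    ... | true | false = refl
    ... | false | _ = refl

weight-⋃ : ∀ {ws : List (Word n)} → AllPairs Disjoint ws → weight (⋃ ws) ≡ sum (map weight ws)
weight-⋃ {n} [] = weight-0w {n}
weight-⋃ {ws = w ∷ _} (w-disj ∷ disj) = trans (weight-∪ (disjoint-⋃ w-disj)) (cong (weight w +_) (weight-⋃ disj))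

-- Linear combinations over F₂

-- Coefficients are paired with words in order; surplus entries on either side are ignored.
linComb : List Bool → List (Word n) → Word n
linComb [] _ = 0w
linComb (_ ∷ _) [] = 0w
linComb (b ∷ s) (w ∷ ws) j = (b ∧ w j) xor linComb s ws j

NonTrivial : ∀ {A : Set} → List Bool → List A → Set
NonTrivial [] _ = ⊥
NonTrivial (_ ∷ _) [] = ⊥
NonTrivial (b ∷ s) (_ ∷ xs) = b ≡ true ⊎ NonTrivial s xs

nonTrivial-map⁻ : ∀ {A B : Set} {f : A → B} s xs → NonTrivial s (map f xs) → NonTrivial s xs
nonTrivial-map⁻ (b ∷ s) (x ∷ xs) (inj₁ b≡true) = inj₁ b≡true
nonTrivial-map⁻ (b ∷ s) (x ∷ xs) (inj₂ nt) = inj₂ (nonTrivial-map⁻ s xs nt)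

LinearlyIndependent : List (Word n) → Set
LinearlyIndependent ws = ∀ s → NonTrivial s ws → ¬ (linComb s ws ≗ 0w)

linComb-cong : ∀ {A : Set} s (l : List A) {f g : A → Word n} → (∀ i → f i ≗ g i) → linComb s (map f l) ≗ linComb s (map g l)
linComb-cong [] l f≗g j = refl
linComb-cong (b ∷ s) [] f≗g j = refl
linComb-cong (b ∷ s) (i ∷ l) f≗g j = cong₂ (λ c d → (b ∧ c) xor d) (f≗g i j) (linComb-cong s l f≗g j)

linComb-⊕ : ∀ {A : Set} s (l : List A) (f g : A → Word n) →
  linComb s (map (λ i → f i ⊕ g i) l) ≗ (linComb s (map f l) ⊕ linComb s (map g l))
linComb-⊕ [] l f g j = refl
linComb-⊕ (b ∷ s) [] f g j = refl
linComb-⊕ (b ∷ s) (i ∷ l) f g j = begin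
  (b ∧ (f i j xor g i j)) xor linComb s (map (λ i → f i ⊕ g i) l) j
    ≡⟨ cong₂ _xor_ (∧-distribˡ-xor b (f i j) (g i j)) (linComb-⊕ s l f g j) ⟩
  ((b ∧ f i j) xor (b ∧ g i j)) xor (linComb s (map f l) j xor linComb s (map g l) j)
    ≡⟨ xor-interchange (b ∧ f i j) (b ∧ g i j) _ _ ⟩
  ((b ∧ f i j) xor linComb s (map f l) j) xor ((b ∧ g i j) xor linComb s (map g l) j) ∎
  where open ≡-Reasoning

linComb-false : ∀ s {ws : List (Word n)} {j} → All (λ w → w j ≡ false) ws → linComb s ws j ≡ false
linComb-false [] _ = refl
linComb-false (b ∷ s) [] = refl
linComb-false (b ∷ s) {w ∷ _} {j} (wj ∷ ws-false) rewrite wj | ∧-zeroʳ b = linComb-false s ws-false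

linComb-⊆ : ∀ s {ws : List (Word n)} {V} → All (_⊆ V) ws → linComb s ws ⊆ V
linComb-⊆ [] _ j ()
linComb-⊆ (b ∷ s) [] j ()
linComb-⊆ (false ∷ s) (_ ∷ ws⊆V) j comb-j = linComb-⊆ s ws⊆V j comb-j
linComb-⊆ (true ∷ s) {w ∷ _} (w⊆V ∷ ws⊆V) j comb-j with xor-true {w j} comb-j
... | inj₁ wj = w⊆V j wj
... | inj₂ rest-j = linComb-⊆ s ws⊆V j rest-j

linComb-units : ∀ s {l : List (Fin n)} → Unique l → NonTrivial s l → Σ (Fin n) λ j → j ∈ l × linComb s (map e l) j ≡ true
linComb-units (b ∷ s) {i ∷ l} (i∉l ∷ _) (inj₁ refl) =
  i , here refl , cong₂ _xor_ (e-diag i) (linComb-false s (Allₚ.map⁺ (All.map (λ i≢k → e-off (≢-sym i≢k)) i∉l)))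
linComb-units (b ∷ s) {i ∷ l} (i∉l ∷ l-unique) (inj₂ nt) with linComb-units s l-unique nt
... | j , j∈l , comb-j = j , there j∈l , cong₂ _xor_ i-silent comb-j
  where
    i-silent : b ∧ e i j ≡ false
    i-silent = trans (cong (b ∧_) (e-off (λ i≡j → Allₚ.All¬⇒¬Any i∉l (subst (_∈ l) (sym i≡j) j∈l)))) (∧-zeroʳ b)

module Pivot (w : Word n) (p : Fin n) where

  reduce : Word n → Word n
  reduce u = u ⊕ (λ j → u p ∧ w j)

  linComb-reduce : ∀ s us → linComb s (map reduce us) ≗ linComb (linComb s us p ∷ s) (w ∷ us)
  linComb-reduce [] us j = refl
  linComb-reduce (b ∷ s) [] j = refl
  linComb-reduce (b ∷ s) (u ∷ us) j = begin
    (b ∧ (u j xor (u p ∧ w j))) xor linComb s (map reduce us) j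
      ≡⟨ cong₂ _xor_ (∧-distribˡ-xor b (u j) (u p ∧ w j)) (linComb-reduce s us j) ⟩
    ((b ∧ u j) xor (b ∧ (u p ∧ w j))) xor ((c ∧ w j) xor L)
      ≡⟨ cong (λ d → ((b ∧ u j) xor d) xor ((c ∧ w j) xor L)) (∧-assoc b (u p) (w j)) ⟨
    ((b ∧ u j) xor ((b ∧ u p) ∧ w j)) xor ((c ∧ w j) xor L)
      ≡⟨ cong (_xor ((c ∧ w j) xor L)) (xor-comm (b ∧ u j) ((b ∧ u p) ∧ w j)) ⟩
    (((b ∧ u p) ∧ w j) xor (b ∧ u j)) xor ((c ∧ w j) xor L)
      ≡⟨ xor-interchange ((b ∧ u p) ∧ w j) (b ∧ u j) (c ∧ w j) L ⟩
    (((b ∧ u p) ∧ w j) xor (c ∧ w j)) xor ((b ∧ u j) xor L)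
      ≡⟨ cong (_xor ((b ∧ u j) xor L)) (∧-distribʳ-xor (w j) (b ∧ u p) c) ⟨
    (((b ∧ u p) xor c) ∧ w j) xor ((b ∧ u j) xor L) ∎
    where
      open ≡-Reasoning
      c L : Bool
      c = linComb s us p
      L = linComb s us j

  reduce-at-pivot : ∀ {u} → w p ≡ true → reduce u p ≡ false
  reduce-at-pivot {u} wp = begin
    u p xor (u p ∧ w p)  ≡⟨ cong (λ b → u p xor (u p ∧ b)) wp ⟩
    u p xor (u p ∧ true) ≡⟨ cong (u p xor_) (∧-identityʳ (u p)) ⟩
    u p xor u p          ≡⟨ xor-same (u p) ⟩
    false                ∎
    where open ≡-Reasoning

  reduce-⊆ : ∀ {u V} → w p ≡ true → w ⊆ V → u ⊆ V → reduce u ⊆ (V ⊕ e p)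
  reduce-⊆ {u} {V} wp w⊆V u⊆V j reduce-j with p ≟ j
  ... | yes refl = contradiction (trans (sym reduce-j) (reduce-at-pivot {u} wp)) λ ()
  ... | no _ = trans (xor-identityʳ (V j)) (V-j (xor-true {u j} reduce-j))
    where
      V-j : u j ≡ true ⊎ (u p ∧ w j) ≡ true → V j ≡ true
      V-j (inj₁ uj) = u⊆V j uj
      V-j (inj₂ upwj) with u p
      ... | true = w⊆V j upwj

  reduce-independent : ∀ {us} → LinearlyIndependent (w ∷ us) → LinearlyIndependent (map reduce us)
  reduce-independent {us} indep s nt comb≗0 =
    indep (linComb s us p ∷ s) (inj₂ (nonTrivial-map⁻ s us nt)) (λ j → trans (sym (linComb-reduce s us j)) (comb≗0 j))

independent-head≢0 : ∀ {w : Word n} {us} → LinearlyIndependent (w ∷ us) → ¬ (w ≗ 0w)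
independent-head≢0 {w = w} indep w≗0 = indep (true ∷ []) (inj₁ refl) (λ j → trans (xor-identityʳ (w j)) (w≗0 j))

-- Steinitz exchange: pivot on a coordinate p of the head and recurse inside V ⊕ e p.
independent⇒length≤weight : ∀ (W : List (Word n)) V → LinearlyIndependent W → All (_⊆ V) W → length W ≤ weight V
independent⇒length≤weight W V = bounded (length W) W V refl
  where
    bounded : ∀ {n} m (W : List (Word n)) V → length W ≡ m → LinearlyIndependent W → All (_⊆ V) W → length W ≤ weight V
    bounded _ [] _ _ _ _ = z≤n
    bounded (suc m) (w ∷ us) V |W|≡ indep (w⊆V ∷ us⊆V) with nonzero-witness w (independent-head≢0 indep)
    ... | p , wp = begin
      suc (length us)              ≡⟨ cong suc (length-map reduce us) ⟨
      suc (length (map reduce us)) ≤⟨ s≤s (bounded m (map reduce us) (V ⊕ e p) |reduced|≡ (reduce-independent indep) reduced⊆) ⟩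
      suc (weight (V ⊕ e p))       ≡⟨ +-comm 1 (weight (V ⊕ e p)) ⟩
      weight (V ⊕ e p) + 1         ≡⟨ weight-⊕-e {u = V} (w⊆V p wp) ⟩
      weight V                     ∎
      where
        open Pivot w p
        open ≤-Reasoning
        |reduced|≡ : length (map reduce us) ≡ m
        |reduced|≡ = trans (length-map reduce us) (suc-injective |W|≡)
        reduced⊆ : All (_⊆ (V ⊕ e p)) (map reduce us)
        reduced⊆ = Allₚ.map⁺ (All.map (reduce-⊆ wp w⊆V) us⊆V)

-- Subspaces and their cosets

record IsSubspace (D : Word n → Set) : Set where
  field
    0w∈ : D 0w
    ⊕-closed : ∀ {u v} → D u → D v → D (u ⊕ v)
    -- words are functions, so invariance under pointwise equality has to be assumed
    ≗-closed : ∀ {u v} → u ≗ v → D u → D v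

  linComb-closed : ∀ s {ws} → All D ws → D (linComb s ws)
  linComb-closed [] _ = 0w∈
  linComb-closed (b ∷ s) [] = 0w∈
  linComb-closed (true ∷ s) (w∈D ∷ ws∈D) = ⊕-closed w∈D (linComb-closed s ws∈D)
  linComb-closed (false ∷ s) (_ ∷ ws∈D) = linComb-closed s ws∈D

dotOn : List (Fin n) → Word n → Word n → Bool
dotOn l u c = foldr _xor_ false (map (λ j → u j ∧ c j) l)

dotOn-⊕ : ∀ l (u v c : Word n) → dotOn l (u ⊕ v) c ≡ dotOn l u c xor dotOn l v c
dotOn-⊕ [] u v c = refl
dotOn-⊕ (j ∷ l) u v c = begin
  ((u j xor v j) ∧ c j) xor dotOn l (u ⊕ v) c
    ≡⟨ cong₂ _xor_ (∧-distribʳ-xor (c j) (u j) (v j)) (dotOn-⊕ l u v c) ⟩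
  ((u j ∧ c j) xor (v j ∧ c j)) xor (dotOn l u c xor dotOn l v c)
    ≡⟨ xor-interchange (u j ∧ c j) (v j ∧ c j) (dotOn l u c) (dotOn l v c) ⟩
  ((u j ∧ c j) xor dotOn l u c) xor ((v j ∧ c j) xor dotOn l v c) ∎
  where open ≡-Reasoning

dotOn-0w : ∀ l (c : Word n) → dotOn l 0w c ≡ false
dotOn-0w [] c = refl
dotOn-0w (j ∷ l) c = dotOn-0w l c

dotOn-cong : ∀ l {u v : Word n} c → u ≗ v → dotOn l u c ≡ dotOn l v c
dotOn-cong l c u≗v = cong (foldr _xor_ false) (map-cong (λ j → cong (_∧ c j) (u≗v j)) l)

-- C⊥ is a subspace whether or not C is linear.
dual-isSubspace : (C : Word n → Set) → IsSubspace (Dual C)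
dual-isSubspace {n} C = record
  { 0w∈ = λ c _ → dotOn-0w (allFin n) c
  ; ⊕-closed = λ {u} {v} u⊥ v⊥ c c∈C → trans (dotOn-⊕ (allFin n) u v c) (cong₂ _xor_ (u⊥ c c∈C) (v⊥ c c∈C))
  ; ≗-closed = λ u≗v u⊥ c c∈C → trans (sym (dotOn-cong (allFin n) c u≗v)) (u⊥ c c∈C)
  }

module Cosets {n} {D : Word n → Set} (D-subspace : IsSubspace D) where

  open IsSubspace D-subspace

  infix 4 _∼_

  record _∼_ (u v : Word n) : Set where
    constructor sameCoset
    field difference∈ : D (u ⊕ v)

  ∼-resp : ∀ {u v u′ v′} → (u ⊕ v) ≗ (u′ ⊕ v′) → u ∼ v → u′ ∼ v′
  ∼-resp eq (sameCoset d) = sameCoset (≗-closed eq d)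

  ∼-sym : ∀ {u v} → u ∼ v → v ∼ u
  ∼-sym {u} {v} = ∼-resp (λ j → xor-comm (u j) (v j))

  ∼-trans : ∀ {u v w} → u ∼ v → v ∼ w → u ∼ w
  ∼-trans {u} {v} {w} (sameCoset d) (sameCoset d′) = sameCoset (≗-closed cancel (⊕-closed d d′))
    where
      cancel : ((u ⊕ v) ⊕ (v ⊕ w)) ≗ (u ⊕ w)
      cancel j = trans (cong ((u j xor v j) xor_) (xor-comm (v j) (w j))) (xor-cancel-shared (u j) (w j) (v j))

  ∼-⊕ : ∀ {u v} w → u ∼ v → (u ⊕ w) ∼ (v ⊕ w)
  ∼-⊕ {u} {v} w = ∼-resp (λ j → sym (xor-cancel-shared (u j) (v j) (w j)))

  ∼-shift : ∀ {u v w} → u ∼ (v ⊕ w) → (u ⊕ w) ∼ v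
  ∼-shift {u} {v} {w} = ∼-resp (λ j → sym (xor-rotate (u j) (w j) (v j)))

  ∼-translate : ∀ {u v s} → D s → u ∼ v → (u ⊕ s) ∼ v
  ∼-translate {u} {v} {s} s∈D (sameCoset d) = sameCoset (≗-closed (λ j → xor-swapʳ (u j) (v j) (s j)) (⊕-closed d s∈D))

  IsLeader : Word n → Set
  IsLeader y = ∀ z → y ∼ z → weight y ≤ weight z

  -- The inequality weight y ≤ weight (y ⊕ s), rewritten via weight-⊕-∩.
  leader-overlap : ∀ {y s} → IsLeader y → D s → 2 * weight (y ∩ s) ≤ weight s
  leader-overlap {y} {s} leader s∈D = +-cancelˡ-≤ (weight (y ⊕ s)) _ _ (begin
    weight (y ⊕ s) + 2 * weight (y ∩ s) ≡⟨ weight-⊕-∩ y s ⟩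
    weight y + weight s                 ≤⟨ +-monoˡ-≤ (weight s) (leader (y ⊕ s) y∼y⊕s) ⟩
    weight (y ⊕ s) + weight s           ∎)
    where
      open ≤-Reasoning
      y∼y⊕s : y ∼ (y ⊕ s)
      y∼y⊕s = sameCoset (≗-closed (λ j → sym (xor-self-cancelˡ (y j) (s j))) s∈D)

  leader-no-codeword-below : ∀ {y s} → IsLeader y → D s → s ⊆ y → s ≗ 0w
  leader-no-codeword-below {y} {s} leader s∈D s⊆y = weight≡0⇒≗0w (n≤0⇒n≡0 (+-cancelʳ-≤ (weight s) (weight s) 0 (begin
    weight s + weight s       ≡⟨ cong (weight s +_) (+-identityʳ (weight s)) ⟨
    2 * weight s              ≡⟨ cong (2 *_) (weight-cong (∩-⊆ s⊆y)) ⟨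
    2 * weight (y ∩ s)        ≤⟨ leader-overlap leader s∈D ⟩
    weight s                  ∎)))
    where open ≤-Reasoning

  walk⇒word : ∀ {k u v} → Walk D k u v → Σ (Word n) λ z → weight z ≤ k × (u ⊕ z) ∼ v
  walk⇒word {u = u} {v} (stop d) =
    0w , ≤-reflexive (weight-0w {n}) , sameCoset (≗-closed (λ j → cong (_xor v j) (sym (xor-identityʳ (u j)))) d)
  walk⇒word {suc k} {u} {v} (step i walk) with walk⇒word walk
  ... | z , |z|≤k , u⊕i⊕z∼v = e i ⊕ z , |e⊕z|≤ , ∼-resp (λ j → cong (_xor v j) (xor-assoc (u j) (e i j) (z j))) u⊕i⊕z∼v
    where
      |e⊕z|≤ : weight (e i ⊕ z) ≤ suc k
      |e⊕z|≤ = ≤-trans (weight-⊕-≤ (e i) z) (≤-trans (≤-reflexive (cong (_+ weight z) (weight-e i))) (s≤s |z|≤k))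

  word⇒walk : ∀ {k u v} (z : Word n) → weight z ≡ k → (u ⊕ z) ∼ v → Walk D k u v
  word⇒walk {zero} {u} {v} z |z|≡0 (sameCoset d) = stop (≗-closed drop-z d)
    where
      drop-z : ((u ⊕ z) ⊕ v) ≗ (u ⊕ v)
      drop-z j = trans (cong (λ b → (u j xor b) xor v j) (weight≡0⇒≗0w |z|≡0 j)) (cong (_xor v j) (xor-identityʳ (u j)))
  word⇒walk {suc k} {u} {v} z |z|≡1+k u⊕z∼v
    with nonzero-witness z (λ z≗0 → contradiction (trans (sym |z|≡1+k) (trans (weight-cong z≗0) (weight-0w {n}))) λ ())
  ... | t , zt = step t (word⇒walk (z ⊕ e t) |z⊕t|≡k (∼-resp (λ j → cong (_xor v j) (sym (xor-cancel-shared (u j) (z j) (e t j)))) u⊕z∼v))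
    where
      |z⊕t|≡k : weight (z ⊕ e t) ≡ k
      |z⊕t|≡k = suc-injective (trans (+-comm 1 _) (trans (weight-⊕-e {u = z} zt) |z|≡1+k))

  inSphere⇒leader : ∀ {r x} → InSphere D r x → Σ (Word n) λ y → y ∼ x × IsLeader y × weight y ≡ r
  inSphere⇒leader {r} {x} (walk , no-shorter) with walk⇒word walk
  ... | y , |y|≤r , y∼x = y , y∼x , leader , ≤-antisym |y|≤r (r≤ y y∼x)
    where
      r≤ : ∀ z → z ∼ x → r ≤ weight z
      r≤ z z∼x = ≮⇒≥ (λ |z|<r → no-shorter (weight z) |z|<r (word⇒walk z refl z∼x))
      leader : IsLeader y
      leader z y∼z = ≤-trans |y|≤r (r≤ z (∼-trans (∼-sym y∼z) y∼x))

  leader⇒inSphere : ∀ {x y} → y ∼ x → IsLeader y → InSphere D (weight y) x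
  leader⇒inSphere {x} {y} y∼x leader = word⇒walk y refl y∼x , no-shorter
    where
      no-shorter : ∀ k → k < weight y → ¬ Walk D k 0w x
      no-shorter k k<|y| walk with walk⇒word walk
      ... | z , |z|≤k , z∼x = <⇒≱ k<|y| (≤-trans (leader z (∼-trans y∼x (∼-sym z∼x))) |z|≤k)

  neighbour-inSphere : ∀ {x y z t} → y ∼ x → IsLeader y → z ∼ (x ⊕ e t) → weight z + 1 ≡ weight y →
    InSphere D (weight y ∸ 1) (x ⊕ e t)
  neighbour-inSphere {x} {y} {z} {t} y∼x leader z∼x⊕t |z|+1≡|y| =
    subst (λ k → InSphere D k (x ⊕ e t)) |z|≡ (leader⇒inSphere z∼x⊕t z-leader)
    where
      |z|≡ : weight z ≡ weight y ∸ 1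
      |z|≡ = trans (sym (m+n∸n≡m (weight z) 1)) (cong (_∸ 1) |z|+1≡|y|)
      z-leader : IsLeader z
      z-leader z′ z∼z′ = +-cancelʳ-≤ 1 (weight z) (weight z′) (begin
        weight z + 1             ≡⟨ |z|+1≡|y| ⟩
        weight y                 ≤⟨ leader (z′ ⊕ e t) (∼-trans y∼x (∼-sym (∼-shift (∼-trans (∼-sym z∼z′) z∼x⊕t)))) ⟩
        weight (z′ ⊕ e t)        ≤⟨ weight-⊕-≤ z′ (e t) ⟩
        weight z′ + weight (e t) ≡⟨ cong (weight z′ +_) (weight-e t) ⟩
        weight z′ + 1            ∎)
        where open ≤-Reasoning

allPairs-∈ : ∀ {A : Set} {R : A → A → Set} {xs x y} → AllPairs R xs → x ∈ xs → y ∈ xs → x ≡ y ⊎ R x y ⊎ R y x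
allPairs-∈ (_ ∷ _) (here refl) (here refl) = inj₁ refl
allPairs-∈ (Rx ∷ _) (here refl) (there y∈) = inj₂ (inj₁ (All.lookup Rx y∈))
allPairs-∈ (Ry ∷ _) (there x∈) (here refl) = inj₂ (inj₂ (All.lookup Ry x∈))
allPairs-∈ (_ ∷ pairs) (there x∈) (there y∈) = allPairs-∈ pairs x∈ y∈

allPairs-mapWithAll : ∀ {A : Set} {P : A → Set} {R S : A → A → Set} {xs} →
  (∀ {x y} → P x → P y → R x y → S x y) → All P xs → AllPairs R xs → AllPairs S xs
allPairs-mapWithAll f [] [] = []
allPairs-mapWithAll f (px ∷ pxs) (Rx ∷ pairs) =
  All.zipWith (λ (py , r) → f px py r) (pxs , Rx) ∷ allPairs-mapWithAll f pxs pairs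

drop-∉-take : ∀ {A : Set} k {xs : List A} → Unique xs → All (_∉ take k xs) (drop k xs)
drop-∉-take zero _ = All.tabulate (λ _ ())
drop-∉-take (suc k) {[]} _ = []
drop-∉-take (suc k) {x ∷ xs} (x∉xs ∷ xs-unique) = All.zipWith ∉-cons (Allₚ.drop⁺ k x∉xs , drop-∉-take k xs-unique)
  where
    ∉-cons : ∀ {y} → x ≢ y × y ∉ take k xs → y ∉ x ∷ take k xs
    ∉-cons (x≢y , _) (here y≡x) = x≢y (sym y≡x)
    ∉-cons (_ , y∉) (there y∈) = y∉ y∈

half≤rest : ∀ r → r / 2 ≤ r ∸ r / 2
half≤rest r = m+n≤o⇒m≤o∸n (r / 2) (begin
  r / 2 + r / 2 ≡⟨ cong (r / 2 +_) (+-identityʳ (r / 2)) ⟨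
  2 * (r / 2)   ≡⟨ *-comm 2 (r / 2) ⟩
  r / 2 * 2     ≤⟨ m/n*n≤m r 2 ⟩
  r             ∎)
  where open ≤-Reasoning

length*≤sum : ∀ {k} (ws : List (Word n)) → All (λ w → k ≤ weight w) ws → length ws * k ≤ sum (map weight ws)
length*≤sum [] [] = z≤n
length*≤sum (w ∷ ws) (k≤w ∷ k≤ws) = +-mono-≤ k≤w (length*≤sum ws k≤ws)

-- 0w is a junk value, returned when no word of the list contains a.
firstContaining : Fin n → List (Word n) → Word n
firstContaining a [] = 0w
firstContaining a (v ∷ vs) = if v a then v else firstContaining a vs

firstContaining-spec : ∀ a {vs : List (Word n)} → Any (λ v → v a ≡ true) vs →
  firstContaining a vs ∈ vs × firstContaining a vs a ≡ true
firstContaining-spec a {v ∷ vs} found with v a in va | found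
... | true | _ = here refl , va
... | false | here va≡true = contradiction (trans (sym va) va≡true) λ ()
... | false | there found′ = let (∈vs , contains) = firstContaining-spec a found′ in there ∈vs , contains

-- Repair groups

-- The second alternative of IsPerfect3LCC C at coordinate i.
RepairFamily : (Word n → Set) → Fin n → List (Word n) → Set
RepairFamily {n} C i L =
  (n ∸ 1 ≤ 3 * length L) × All (λ v → Dual C v × weight v ≡ 4 × v i ≡ true) L × AllPairs (DisjointApart i) L

punctured-centre : ∀ {i} {v : Word n} → v i ≡ true → (v ⊕ e i) i ≡ false
punctured-centre {i = i} vi = cong₂ _xor_ vi (e-diag i)

punctured-disjoint : ∀ {i} {v w : Word n} → v i ≡ true → DisjointApart i v w → Disjoint (v ⊕ e i) (w ⊕ e i)
punctured-disjoint {i = i} {v} {w} vi apart j vj wj with i ≟ j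
... | yes refl = contradiction (trans (sym (cong (_xor true) vi)) vj) λ ()
... | no i≢j = apart j (≢-sym i≢j) (trans (sym (xor-identityʳ (v j))) vj) (trans (sym (xor-identityʳ (w j))) wj)

-- Without i the repair groups are disjoint triples, so an uncovered t ≠ i would force 3 * length L + 2 ≤ n.
repair-covers : ∀ {C : Word n → Set} {i L} → RepairFamily C i L → ∀ t → t ≢ i → Any (λ v → v t ≡ true) L
repair-covers {n} {C} {i} {L} (long , members , apart) t t≢i with any? (λ v → v t ≟ᵇ true) L
... | yes covered = covered
... | no uncovered = ⊥-elim (1+n≰n (begin
  2 + 3 * length L ≡⟨ +-comm 2 (3 * length L) ⟩
  3 * length L + 2 ≤⟨ room ⟩
  n                ≤⟨ m≤n+m∸n n 1 ⟩
  1 + (n ∸ 1)      ≤⟨ +-monoʳ-≤ 1 long ⟩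
  1 + 3 * length L ∎))
  where
    open ≤-Reasoning
    punctured : List (Word n)
    punctured = map (_⊕ e i) L
    U : Word n
    U = ⋃ punctured
    |U| : weight U ≡ 3 * length L
    |U| = trans (weight-⋃ (AllPairsₚ.map⁺ (allPairs-mapWithAll (λ {v} (_ , _ , vi) _ → punctured-disjoint {v = v} vi) members apart)))
                (sums L members)
      where
        sums : ∀ L′ → All (λ v → Dual C v × weight v ≡ 4 × v i ≡ true) L′ → sum (map weight (map (_⊕ e i) L′)) ≡ 3 * length L′
        sums [] [] = refl
        sums (v ∷ L′) ((_ , |v|≡4 , vi) ∷ members′) =
          trans (cong₂ _+_ (+-cancelʳ-≡ 1 (weight (v ⊕ e i)) 3 (trans (weight-⊕-e {u = v} {t = i} vi) |v|≡4)) (sums L′ members′))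
                (sym (*-distribˡ-+ 3 1 (length L′)))
    Ui : U i ≡ false
    Ui = ¬-not (λ Ui → All.lookupWith (λ {v} (_ , _ , vi) vi′ → contradiction (trans (sym (punctured-centre {v = v} vi)) vi′) λ ())
                                      members (Anyₚ.map⁻ (⋃⁻ punctured Ui)))
    Ut : U t ≡ false
    Ut = ¬-not (λ Ut → uncovered (Any.map (λ {v} vt → trans (sym (xor-identityʳ (v t))) (trans (cong (v t xor_) (sym (e-off (≢-sym t≢i)))) vt))
                                   (Anyₚ.map⁻ (⋃⁻ punctured Ut))))
    room : 3 * length L + 2 ≤ n
    room = begin
      3 * length L + 2     ≤⟨ +-monoʳ-≤ (3 * length L) (unique⇒length≤weight (∁ U) ((≢-sym t≢i ∷ []) ∷ [] ∷ []) (cong not Ui ∷ cong not Ut ∷ [])) ⟩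
      3 * length L + weight (∁ U) ≡⟨ cong (_+ weight (∁ U)) |U| ⟨
      weight U + weight (∁ U) ≡⟨ weight-∁ U ⟩
      n ∎

-- The descent

module Descent {n} {C : Word n → Set} (lcc : IsPerfect3LCC C) where

  open IsSubspace (dual-isSubspace C)
  open Cosets (dual-isSubspace C)

  -- [] is a junk value, used when e i ∈ C⊥.
  repairs : Fin n → List (Word n)
  repairs i = [ (λ _ → []) , proj₁ ]′ (lcc i)

  block : Fin n → Fin n → Word n
  block i a = firstContaining a (repairs i)

  -- the two coordinates of block i a other than i and a
  blockTail : Fin n → Fin n → Word n
  blockTail i a = block i a ⊕ (e i ⊕ e a)

  module Around {x y : Word n} (y∼x : y ∼ x) (leader : IsLeader y) where

    repairs-family : ∀ {i} → y i ≡ true → RepairFamily C i (repairs i)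
    repairs-family {i} yi with lcc i
    ... | inj₁ ei∈C⊥ = contradiction (trans (sym (e-diag i)) (leader-no-codeword-below leader ei∈C⊥ (e-⊆ {u = y} yi) i)) λ ()
    ... | inj₂ (_ , family) = family

    module Block {i a : Fin n} (yi : y i ≡ true) (ya : y a ≡ true) (i≢a : i ≢ a) where

      private
        found : block i a ∈ repairs i × block i a a ≡ true
        found = firstContaining-spec a (repair-covers (repairs-family yi) a (≢-sym i≢a))
        member : Dual C (block i a) × weight (block i a) ≡ 4 × block i a i ≡ true
        member = All.lookup (proj₁ (proj₂ (repairs-family yi))) (proj₁ found)

      ∈repairs : block i a ∈ repairs i
      ∈repairs = proj₁ found

      has-a : block i a a ≡ true
      has-a = proj₂ found

      codeword : Dual C (block i a)
      codeword = proj₁ member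

      weight≡4 : weight (block i a) ≡ 4
      weight≡4 = proj₁ (proj₂ member)

      has-i : block i a i ≡ true
      has-i = proj₂ (proj₂ member)

      overlap≤2 : weight (y ∩ block i a) ≤ 2
      overlap≤2 = *-cancelˡ-≤ 2 (≤-trans (leader-overlap leader codeword) (≤-reflexive weight≡4))

      meets-y-only-at-i-a : ∀ {p} → y p ≡ true → block i a p ≡ true → p ≢ i → p ≢ a → ⊥
      meets-y-only-at-i-a yp bp p≢i p≢a = contradiction (≤-trans three overlap≤2) (from-no (3 ≤? 2))
        where
          three : 3 ≤ weight (y ∩ block i a)
          three = unique⇒length≤weight (y ∩ block i a) ((i≢a ∷ ≢-sym p≢i ∷ []) ∷ (≢-sym p≢a ∷ []) ∷ [] ∷ [])
                    (cong₂ _∧_ yi has-i ∷ cong₂ _∧_ ya has-a ∷ cong₂ _∧_ yp bp ∷ [])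

      weight-y⊕block : weight (y ⊕ block i a) ≡ weight y
      weight-y⊕block = +-cancelʳ-≡ 4 _ _ (begin
        weight (y ⊕ block i a) + 4                           ≡⟨ cong (λ k → weight (y ⊕ block i a) + 2 * k) overlap≡2 ⟨
        weight (y ⊕ block i a) + 2 * weight (y ∩ block i a) ≡⟨ weight-⊕-∩ y (block i a) ⟩
        weight y + weight (block i a)                        ≡⟨ cong (weight y +_) weight≡4 ⟩
        weight y + 4                                         ∎)
        where
          open ≡-Reasoning
          overlap≡2 : weight (y ∩ block i a) ≡ 2
          overlap≡2 = ≤-antisym overlap≤2
            (unique⇒length≤weight (y ∩ block i a) ((i≢a ∷ []) ∷ [] ∷ []) (cong₂ _∧_ yi has-i ∷ cong₂ _∧_ ya has-a ∷ []))

      tail-spec : ∀ {t} → blockTail i a t ≡ true → t ≢ i × block i a t ≡ true × y t ≡ false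
      tail-spec {t} tail-t with i ≟ t | a ≟ t
      ... | yes i≡t | yes a≡t = contradiction (trans i≡t (sym a≡t)) i≢a
      ... | yes i≡t | no _ = contradiction (trans (sym (cong (_xor true) (subst (λ k → block i a k ≡ true) i≡t has-i))) tail-t) λ ()
      ... | no _ | yes a≡t = contradiction (trans (sym (cong (_xor true) (subst (λ k → block i a k ≡ true) a≡t has-a))) tail-t) λ ()
      ... | no i≢t | no a≢t = ≢-sym i≢t , bt , ¬-not (λ yt → meets-y-only-at-i-a yt bt (≢-sym i≢t) (≢-sym a≢t))
        where
          bt : block i a t ≡ true
          bt = trans (sym (xor-identityʳ (block i a t))) tail-t

      tail-descends : ∀ {t} → blockTail i a t ≡ true → InSphere (Dual C) (weight y ∸ 1) (x ⊕ e t)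
      tail-descends {t} tail-t = neighbour-inSphere {t = t} y∼x leader (∼-⊕ (e t) (∼-translate codeword y∼x)) (trans (weight-⊕-e {u = y ⊕ block i a} yb-t) weight-y⊕block)
        where
          spec : t ≢ i × block i a t ≡ true × y t ≡ false
          spec = tail-spec tail-t
          yb-t : (y ⊕ block i a) t ≡ true
          yb-t = cong₂ _xor_ (proj₂ (proj₂ spec)) (proj₁ (proj₂ spec))

    same-centre-disjoint : ∀ {i a a′} → y i ≡ true → y a ≡ true → y a′ ≡ true → i ≢ a → i ≢ a′ → a ≢ a′ →
      Disjoint (blockTail i a) (blockTail i a′)
    same-centre-disjoint {i} {a} {a′} yi ya ya′ i≢a i≢a′ a≢a′ t tail tail′ =
      cases (allPairs-∈ (proj₂ (proj₂ (repairs-family yi))) B.∈repairs B′.∈repairs)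
      where
        module B = Block yi ya i≢a
        module B′ = Block yi ya′ i≢a′
        t≢i : t ≢ i
        t≢i = proj₁ (B.tail-spec tail)
        bt : block i a t ≡ true
        bt = proj₁ (proj₂ (B.tail-spec tail))
        bt′ : block i a′ t ≡ true
        bt′ = proj₁ (proj₂ (B′.tail-spec tail′))
        cases : block i a ≡ block i a′ ⊎ DisjointApart i (block i a) (block i a′) ⊎ DisjointApart i (block i a′) (block i a) → ⊥
        cases (inj₁ same) = B.meets-y-only-at-i-a ya′ (subst (λ v → v a′ ≡ true) (sym same) B′.has-a) (≢-sym i≢a′) (≢-sym a≢a′)
        cases (inj₂ (inj₁ apart)) = apart t t≢i bt bt′
        cases (inj₂ (inj₂ apart)) = apart t t≢i bt′ bt

    distinct-centres-disjoint : ∀ {i a i′ a′} → y i ≡ true → y a ≡ true → y i′ ≡ true → y a′ ≡ true →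
      Unique (i ∷ a ∷ i′ ∷ a′ ∷ []) → Disjoint (blockTail i a) (blockTail i′ a′)
    distinct-centres-disjoint {i} {a} {i′} {a′} yi ya yi′ ya′
      distinct@((i≢a ∷ i≢i′ ∷ i≢a′ ∷ []) ∷ (a≢i′ ∷ a≢a′ ∷ []) ∷ (i′≢a′ ∷ []) ∷ [] ∷ []) t tail tail′ =
      contradiction (≤-trans eight≤ |s|≤6) (from-no (8 ≤? 6))
      where
        module B = Block yi ya i≢a
        module B′ = Block yi′ ya′ i′≢a′
        v v′ s : Word n
        v = block i a
        v′ = block i′ a′
        s = v ⊕ v′
        v′i : v′ i ≡ false
        v′i = ¬-not (λ v′i → B′.meets-y-only-at-i-a yi v′i i≢i′ i≢a′)
        v′a : v′ a ≡ false
        v′a = ¬-not (λ v′a → B′.meets-y-only-at-i-a ya v′a a≢i′ a≢a′)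
        vi′ : v i′ ≡ false
        vi′ = ¬-not (λ vi′ → B.meets-y-only-at-i-a yi′ vi′ (≢-sym i≢i′) (≢-sym a≢i′))
        va′ : v a′ ≡ false
        va′ = ¬-not (λ va′ → B.meets-y-only-at-i-a ya′ va′ (≢-sym i≢a′) (≢-sym a≢a′))
        four : 4 ≤ weight (y ∩ s)
        four = unique⇒length≤weight (y ∩ s) distinct
          (cong₂ _∧_ yi (cong₂ _xor_ B.has-i v′i) ∷ cong₂ _∧_ ya (cong₂ _xor_ B.has-a v′a) ∷
           cong₂ _∧_ yi′ (cong₂ _xor_ vi′ B′.has-i) ∷ cong₂ _∧_ ya′ (cong₂ _xor_ va′ B′.has-a) ∷ [])
        eight≤ : 8 ≤ weight s
        eight≤ = ≤-trans (*-monoʳ-≤ 2 four) (leader-overlap leader (⊕-closed B.codeword B′.codeword))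
        meet : 1 ≤ weight (v ∩ v′)
        meet = unique⇒length≤weight (v ∩ v′) ([] ∷ [])
          (cong₂ _∧_ (proj₁ (proj₂ (B.tail-spec tail))) (proj₁ (proj₂ (B′.tail-spec tail′))) ∷ [])
        |s|≤6 : weight s ≤ 6
        |s|≤6 = +-cancelʳ-≤ 2 (weight s) 6 (begin
          weight s + 2                 ≤⟨ +-monoʳ-≤ (weight s) (*-monoʳ-≤ 2 meet) ⟩
          weight s + 2 * weight (v ∩ v′) ≡⟨ weight-⊕-∩ v v′ ⟩
          weight v + weight v′         ≡⟨ cong₂ _+_ B.weight≡4 B′.weight≡4 ⟩
          8                            ∎)
          where open ≤-Reasoning

    module _ {A₁ : List (Fin n)} (A₁-unique : Unique A₁) (A₁⊆y : All (λ i → y i ≡ true) A₁) where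

      Outside : Fin n → Set
      Outside a = y a ≡ true × a ∉ A₁

      ∈A₁⇒≢ : ∀ {i a} → i ∈ A₁ → Outside a → i ≢ a
      ∈A₁⇒≢ i∈ (_ , a∉) refl = a∉ i∈

      tails : Fin n → List (Word n)
      tails a = map (λ i → blockTail i a) A₁

      tailUnion : Fin n → Word n
      tailUnion a = ⋃ (tails a)

      tails-disjoint : ∀ {i i′ a a′} → i ∈ A₁ → i′ ∈ A₁ → Outside a → Outside a′ → a ≢ a′ →
        Disjoint (blockTail i a) (blockTail i′ a′)
      tails-disjoint {i} {i′} i∈ i′∈ out@(ya , _) out′@(ya′ , _) a≢a′ with i ≟ i′
      ... | yes refl = same-centre-disjoint (All.lookup A₁⊆y i∈) ya ya′ (∈A₁⇒≢ i∈ out) (∈A₁⇒≢ i∈ out′) a≢a′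
      ... | no i≢i′ = distinct-centres-disjoint (All.lookup A₁⊆y i∈) ya (All.lookup A₁⊆y i′∈) ya′
        ((∈A₁⇒≢ i∈ out ∷ i≢i′ ∷ ∈A₁⇒≢ i∈ out′ ∷ []) ∷ (≢-sym (∈A₁⇒≢ i′∈ out) ∷ a≢a′ ∷ []) ∷ (∈A₁⇒≢ i′∈ out′ ∷ []) ∷ [] ∷ [])

      tailUnions-disjoint : ∀ {a a′} → Outside a → Outside a′ → a ≢ a′ → Disjoint (tailUnion a) (tailUnion a′)
      tailUnions-disjoint {a} {a′} out out′ a≢a′ t Ut Ut′
        with find (Anyₚ.map⁻ (⋃⁻ (tails a) Ut)) | find (Anyₚ.map⁻ (⋃⁻ (tails a′) Ut′))
      ... | _ , i∈ , tail | _ , i′∈ , tail′ = tails-disjoint i∈ i′∈ out out′ a≢a′ t tail tail′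

      tailUnion-descends : ∀ {a t} → Outside a → tailUnion a t ≡ true → InSphere (Dual C) (weight y ∸ 1) (x ⊕ e t)
      tailUnion-descends {a} out Ut with find (Anyₚ.map⁻ (⋃⁻ (tails a) Ut))
      ... | _ , i∈ , tail = Block.tail-descends (All.lookup A₁⊆y i∈) (proj₁ out) (∈A₁⇒≢ i∈ out) tail

      tails-independent : ∀ {a} → Outside a → LinearlyIndependent (tails a)
      tails-independent {a} out@(ya , _) s nt tails≗0 = contradiction (trans (sym Y-j₀) (Y≗0 j₀)) λ ()
        where
          pair : Fin n → Word n
          pair i = e i ⊕ e a
          Y : Word n
          Y = linComb s (map pair A₁)
          blocks≗Y : linComb s (map (λ i → block i a) A₁) ≗ Y
          blocks≗Y j = begin
            linComb s (map (λ i → block i a) A₁) j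
              ≡⟨ linComb-cong s A₁ (λ i k → sym (xor-self-cancelʳ (block i a k) (pair i k))) j ⟩
            linComb s (map (λ i → blockTail i a ⊕ pair i) A₁) j
              ≡⟨ linComb-⊕ s A₁ (λ i → blockTail i a) pair j ⟩
            linComb s (tails a) j xor Y j
              ≡⟨ cong (_xor Y j) (tails≗0 j) ⟩
            Y j ∎
            where open ≡-Reasoning
          Y∈C⊥ : Dual C Y
          Y∈C⊥ = ≗-closed blocks≗Y
            (linComb-closed s (Allₚ.map⁺ (All.tabulate (λ i∈ → Block.codeword (All.lookup A₁⊆y i∈) ya (∈A₁⇒≢ i∈ out)))))
          pair⊆y : ∀ {i} → y i ≡ true → pair i ⊆ y
          pair⊆y {i} yi j pair-j with xor-true {e i j} pair-j
          ... | inj₁ eij = e-⊆ {u = y} yi j eij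
          ... | inj₂ eaj = e-⊆ {u = y} ya j eaj
          Y≗0 : Y ≗ 0w
          Y≗0 = leader-no-codeword-below leader Y∈C⊥ (linComb-⊆ s (Allₚ.map⁺ (All.map pair⊆y A₁⊆y)))
          witness : Σ (Fin n) λ j → j ∈ A₁ × linComb s (map e A₁) j ≡ true
          witness = linComb-units s A₁-unique (nonTrivial-map⁻ s A₁ nt)
          j₀ : Fin n
          j₀ = proj₁ witness
          Y-j₀ : Y j₀ ≡ true
          Y-j₀ = trans (linComb-⊕ s A₁ e (λ _ → e a) j₀)
            (cong₂ _xor_ (proj₂ (proj₂ witness))
                         (linComb-false s (Allₚ.map⁺ (All.tabulate (λ _ → e-off (≢-sym (∈A₁⇒≢ (proj₁ (proj₂ witness)) out)))))))

      tailUnion-weight : ∀ {a} → Outside a → length A₁ ≤ weight (tailUnion a)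
      tailUnion-weight {a} out = subst (_≤ weight (tailUnion a)) (length-map (λ i → blockTail i a) A₁)
        (independent⇒length≤weight (tails a) (tailUnion a) (tails-independent out) (All.tabulate ⊆-⋃))

      descent : ∀ {A₂} → Unique A₂ → All Outside A₂ → Σ (List (Fin n)) λ I →
        Unique I × length A₂ * length A₁ ≤ length I × All (λ t → InSphere (Dual C) (weight y ∸ 1) (x ⊕ e t)) I
      descent {A₂} A₂-unique A₂-outside = support U , support-unique U , size , All.map descends (all-support U)
        where
          U : Word n
          U = ⋃ (map tailUnion A₂)
          size : length A₂ * length A₁ ≤ length (support U)
          size = begin
            length A₂ * length A₁                 ≡⟨ cong (_* length A₁) (length-map tailUnion A₂) ⟨
            length (map tailUnion A₂) * length A₁ ≤⟨ length*≤sum (map tailUnion A₂) (Allₚ.map⁺ (All.map tailUnion-weight A₂-outside)) ⟩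
            sum (map weight (map tailUnion A₂))   ≡⟨ weight-⋃ (AllPairsₚ.map⁺ (allPairs-mapWithAll tailUnions-disjoint A₂-outside A₂-unique)) ⟨
            weight U                              ≡⟨ length-support U ⟨
            length (support U)                    ∎
            where open ≤-Reasoning
          descends : ∀ {t} → U t ≡ true → InSphere (Dual C) (weight y ∸ 1) (x ⊕ e t)
          descends Ut with find (Anyₚ.map⁻ (⋃⁻ (map tailUnion A₂) Ut))
          ... | _ , a∈ , Vat = tailUnion-descends (All.lookup A₂-outside a∈) Vat

    lower-neighbours : Σ (List (Fin n)) λ I →
      Unique I × (weight y / 2) * (weight y / 2) ≤ length I × All (λ t → InSphere (Dual C) (weight y ∸ 1) (x ⊕ e t)) I
    lower-neighbours =
      let (I , I-unique , size , descends) = descent A₁-unique A₁⊆y A₂-unique A₂-outside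
      in I , I-unique , ≤-trans (*-mono-≤ h≤|A₂| (≤-reflexive (sym |A₁|≡h))) size , descends
      where
        h : ℕ
        h = weight y / 2
        A : List (Fin n)
        A = support y
        A₁-unique : Unique (take h A)
        A₁-unique = take⁺ h (support-unique y)
        A₁⊆y : All (λ i → y i ≡ true) (take h A)
        A₁⊆y = Allₚ.take⁺ h (all-support y)
        A₂-unique : Unique (drop h A)
        A₂-unique = drop⁺ h (support-unique y)
        A₂-outside : All (λ a → y a ≡ true × a ∉ take h A) (drop h A)
        A₂-outside = All.zip (Allₚ.drop⁺ h (all-support y) , drop-∉-take h (support-unique y))
        |A₁|≡h : length (take h A) ≡ h
        |A₁|≡h = trans (length-take h A) (trans (cong (h ⊓_) (length-support y)) (m≤n⇒m⊓n≡m (m/n≤m (weight y) 2)))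
        h≤|A₂| : h ≤ length (drop h A)
        h≤|A₂| = ≤-trans (half≤rest (weight y)) (≤-reflexive (sym (trans (length-drop h A) (cong (_∸ h) (length-support y)))))

lemma3p3 : (n : ℕ) (C : Word n → Set) → IsLinearCode C → IsPerfect3LCC C →
    (r : ℕ) → 2 ≤ r → (x : Word n) → InSphere (Dual C) r x →
    Σ (List (Fin n)) (λ I →
        Unique I
      × ((r / 2) * (r / 2) ≤ length I)
      × All (λ i → InSphere (Dual C) (r ∸ 1) (x ⊕ e i)) I)
lemma3p3 n C _ lcc r _ x x∈Sᵣ with Cosets.inSphere⇒leader (dual-isSubspace C) x∈Sᵣ
... | y , y∼x , leader , refl = Descent.Around.lower-neighbours lcc y∼x leader
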